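{- Let $k\ge 1$ be an integer and let $G$ be a graph with minimum degree $\delta(G)\ge k$. Then $G$ has a $k$-coalition partition.
   Context: All graphs are finite, simple and undirected. For an integer $k\ge 1$, a set $S\subseteq V(G)$ is a $k$-dominating set of $G$ if every vertex of $V(G)\setminus S$ has at least $k$ neighbours in $S$. Two sets $U_1,U_2\subseteq V(G)$ form a $k$-coalition (are $k$-coalition partners) if neither $U_1$ nor $U_2$ is a $k$-dominating set of $G$, but $U_1\cup U_2$ is a $k$-dominating set of $G$. A $k$-coalition partition of $G$ is a partition $\Theta$ of $V(G)$ into nonempty sets such that every set of $\Theta$ either is a $k$-dominating set of $G$ with exactly $k$ elements, or forms a $k$-coalition with some other set of $\Theta$. -}

module Defs where

open import Data.Nat using (ℕ; _≤_)
open import Data.Bool using (Bool; true; false)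
open import Data.Fin using (Fin; _≟_)
open import Data.Fin.Subset using (Subset; _∈_; _∉_; _∪_; _∩_; ∣_∣)
open import Data.Vec using (tabulate)
open import Data.Product using (Σ; _×_; ∃)
open import Data.Sum using (_⊎_)
open import Relation.Nullary using (¬_)
open import Relation.Nullary.Decidable using (⌊_⌋)
open import Relation.Binary.PropositionalEquality using (_≡_; _≢_)
open import Function using (Surjective)

record Graph (n : ℕ) : Set where
  field
    adj    : Fin n → Fin n → Bool
    sym    : ∀ u v → adj u v ≡ adj v u
    irrefl : ∀ v → adj v v ≡ false

module _ {n : ℕ} (G : Graph n) where
  open Graph G

  N : Fin n → Subset n
  N v = tabulate (adj v)

  deg : Fin n → ℕ
  deg v = ∣ N v ∣

  MinDegreeAtLeast : ℕ → Set
  MinDegreeAtLeast k = ∀ v → k ≤ deg v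

  IsKDominating : ℕ → Subset n → Set
  IsKDominating k S = ∀ v → v ∉ S → k ≤ ∣ N v ∩ S ∣

  IsKCoalition : ℕ → Subset n → Subset n → Set
  IsKCoalition k U₁ U₂ =
    ¬ IsKDominating k U₁ × ¬ IsKDominating k U₂ × IsKDominating k (U₁ ∪ U₂)

  -- A partition of V(G) into m nonempty classes is given by a surjective
  -- class-assignment map part : Fin n → Fin m; class i = { v | part v = i }.
  classOf : {m : ℕ} → (Fin n → Fin m) → Fin m → Subset n
  classOf part i = tabulate (λ v → ⌊ part v ≟ i ⌋)

  IsKCoalitionPartition : ℕ → {m : ℕ} → (Fin n → Fin m) → Set
  IsKCoalitionPartition k {m} part =
    Surjective _≡_ _≡_ part ×
    (∀ i → (IsKDominating k (classOf part i) × ∣ classOf part i ∣ ≡ k)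
           ⊎ (Σ (Fin m) λ j → j ≢ i × IsKCoalition k (classOf part i) (classOf part j)))

  HasKCoalitionPartition : ℕ → Set
  HasKCoalitionPartition k = Σ ℕ λ m → Σ (Fin n → Fin m) λ part → IsKCoalitionPartition k part

-- Grow a maximal set A that is not k-dominating and partition V(G) into A and
-- the singletons outside A. By maximality A ∪ {y} is k-dominating for every y ∉ A,
-- so {y} is a k-coalition partner of A unless {y} is itself k-dominating; since y
-- has a neighbour, and that neighbour has at most one neighbour in {y}, this forces
-- k = 1 = |{y}|. A partner of A is {w} for a vertex w ∉ A with fewer than k
-- neighbours in A: were {w} k-dominating, then k = 1 and every vertex of A would be
-- a neighbour of w.
module Submission where

open import Defs
open import Data.Nat using (ℕ; zero; suc; _≤_; _<_; _≤?_)
open import Data.Nat.Properties using (≤-trans; ≤-antisym; <⇒≱; ≰⇒>)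
open import Data.Bool using (Bool; true)
import Data.Bool.Properties as Bool
open import Data.Fin using (Fin; zero; suc; _≟_)
open import Data.Fin.Subset
open import Data.Fin.Subset.Properties
open import Data.Fin.Properties using (all?; any?; ¬∀⟶∃¬)
open import Data.List using (List; []; _∷_; foldl; allFin)
open import Data.List.Membership.Propositional using () renaming (_∈_ to _∈ₗ_)
open import Data.List.Membership.Propositional.Properties using (∈-allFin)
open import Data.List.Relation.Unary.Any using (here; there)
open import Data.Vec using (tabulate)
open import Data.Vec.Properties using (lookup∘tabulate; []=⇒lookup; lookup⇒[]=; ≡-dec)
import Data.Vec.Functional as Vector
open import Data.Product using (Σ; _×_; ∃; _,_; proj₁; proj₂; map)
open import Data.Sum using (_⊎_; inj₁; inj₂)
open import Relation.Nullary using (¬_; Dec; yes; no; contradiction; ¬?)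
open import Relation.Nullary.Decidable using (isYes≗does; dec-true; _→-dec_)
open import Relation.Unary using (Decidable)
open import Relation.Binary.Definitions using (DecidableEquality)
open import Relation.Binary.PropositionalEquality using (_≡_; _≢_; refl; sym; trans; cong; subst)
open import Function using (_∘_; id; const; Injective; StrictlySurjective)
open import Function.Consequences using (strictlySurjective⇒surjective)

record ImageFactorisation {n : ℕ} {X : Set} (f : Fin n → X) : Set where
  field
    size       : ℕ
    surjection : Fin n → Fin size
    injection  : Fin size → X
    factors    : ∀ v → injection (surjection v) ≡ f v
    injective  : Injective _≡_ _≡_ injection
    surjective : StrictlySurjective _≡_ surjection

  surjection-kernel : ∀ {u v} → surjection u ≡ surjection v → f u ≡ f v
  surjection-kernel {u} {v} e = trans (sym (factors u)) (trans (cong injection e) (factors v))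

  kernel-surjection : ∀ {u v} → f u ≡ f v → surjection u ≡ surjection v
  kernel-surjection {u} {v} e = injective (trans (factors u) (trans e (sym (factors v))))

imageFactorisation : {X : Set} → DecidableEquality X →
                     ∀ {n} (f : Fin n → X) → ImageFactorisation f
imageFactorisation _≟X_ {zero} f = record
  { size = 0 ; surjection = λ () ; injection = λ () ; factors = λ ()
  ; injective = λ { {()} } ; surjective = λ () }
imageFactorisation _≟X_ {suc n} f = extend (any? (λ i → injection i ≟X f zero))
  where
  open ImageFactorisation (imageFactorisation _≟X_ (f ∘ suc))

  extend : Dec (∃ λ i → injection i ≡ f zero) → ImageFactorisation f
  extend (yes (i , hit)) = record
    { size = size ; surjection = i Vector.∷ surjection ; injection = injection
    ; factors = λ { zero → hit ; (suc v) → factors v }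
    ; injective = injective
    ; surjective = map suc id ∘ surjective }
  extend (no miss) = record
    { size = suc size ; surjection = zero Vector.∷ (suc ∘ surjection)
    ; injection = f zero Vector.∷ injection
    ; factors = λ { zero → refl ; (suc v) → factors v }
    ; injective = new-injective
    ; surjective = λ { zero → zero , refl
                     ; (suc j) → map suc (cong suc) (surjective j) } }
    where
    new-injective : Injective _≡_ _≡_ (f zero Vector.∷ injection)
    new-injective {zero}  {zero}  _ = refl
    new-injective {zero}  {suc j} e = contradiction (j , sym e) miss
    new-injective {suc i} {zero}  e = contradiction (i , e) miss
    new-injective {suc i} {suc j} e = cong suc (injective e)

module _ {n : ℕ} where

  ∈-tabulate⁺ : {p : Fin n → Bool} {x : Fin n} → p x ≡ true → x ∈ tabulate p
  ∈-tabulate⁺ {p} {x} e = lookup⇒[]= x _ (trans (lookup∘tabulate p x) e)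

  ∈-tabulate⁻ : {p : Fin n → Bool} {x : Fin n} → x ∈ tabulate p → p x ≡ true
  ∈-tabulate⁻ {p} {x} x∈ = trans (sym (lookup∘tabulate p x)) ([]=⇒lookup x∈)

  x∈p⇒0<∣p∣ : {x : Fin n} {p : Subset n} → x ∈ p → 0 < ∣ p ∣
  x∈p⇒0<∣p∣ {x} {p} x∈p = subst (_≤ ∣ p ∣) (∣⁅x⁆∣≡1 x)
    (p⊆q⇒∣p∣≤∣q∣ (λ y∈ → subst (_∈ p) (sym (x∈⁅y⁆⇒x≡y x y∈)) x∈p))

  0<∣p∣⇒Nonempty : {p : Subset n} → 0 < ∣ p ∣ → Nonempty p
  0<∣p∣⇒Nonempty {p} 0<∣p∣ with nonempty? p
  ... | yes ne = ne
  ... | no empty with subst (0 <_) (trans (cong ∣_∣ (Empty-unique empty)) (∣⊥∣≡0 n)) 0<∣p∣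
  ...   | ()

  ∩-monoʳ : (p : Subset n) {q r : Subset n} → q ⊆ r → p ∩ q ⊆ p ∩ r
  ∩-monoʳ p q⊆r x∈ with x∈p∩q⁻ p _ x∈
  ... | x∈p , x∈q = x∈p∩q⁺ (x∈p , q⊆r x∈q)

  ∪-monoˡ : (r : Subset n) {p q : Subset n} → p ⊆ q → p ∪ r ⊆ q ∪ r
  ∪-monoˡ r {p} p⊆q x∈ with x∈p∪q⁻ p r x∈
  ... | inj₁ x∈p = x∈p∪q⁺ (inj₁ (p⊆q x∈p))
  ... | inj₂ x∈r = x∈p∪q⁺ (inj₂ x∈r)

  blockOf : Subset n → Fin n → Subset n
  blockOf A v with v ∈? A
  ... | yes _ = A
  ... | no  _ = ⁅ v ⁆

  blockOf-inside : ∀ {A v} → v ∈ A → blockOf A v ≡ A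
  blockOf-inside {A} {v} v∈A with v ∈? A
  ... | yes _   = refl
  ... | no v∉A = contradiction v∈A v∉A

  blockOf-outside : ∀ {A v} → v ∉ A → blockOf A v ≡ ⁅ v ⁆
  blockOf-outside {A} {v} v∉A with v ∈? A
  ... | yes v∈A = contradiction v∈A v∉A
  ... | no _    = refl

  ∈-blockOf : ∀ A v → v ∈ blockOf A v
  ∈-blockOf A v with v ∈? A
  ... | yes v∈A = v∈A
  ... | no  _   = x∈⁅x⁆ v

  blockOf-closed : ∀ A v {u} → u ∈ blockOf A v → blockOf A u ≡ blockOf A v
  blockOf-closed A v u∈ with v ∈? A
  ... | yes _   = blockOf-inside u∈
  ... | no v∉A = trans (cong (blockOf A) (x∈⁅y⁆⇒x≡y v u∈)) (blockOf-outside v∉A)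

MaximalNon : {n : ℕ} → (Subset n → Set) → Subset n → Set
MaximalNon P A = ¬ P A × (∀ y → y ∉ A → P (A ∪ ⁅ y ⁆))

module Greedy {n : ℕ} {P : Subset n → Set} (P? : Decidable P)
              (P-mono : ∀ {S T} → S ⊆ T → P S → P T) where

  step : Subset n → Fin n → Subset n
  step A y with P? (A ∪ ⁅ y ⁆)
  ... | yes _ = A
  ... | no  _ = A ∪ ⁅ y ⁆

  step-⊆ : ∀ A y → A ⊆ step A y
  step-⊆ A y with P? (A ∪ ⁅ y ⁆)
  ... | yes _ = id
  ... | no  _ = p⊆p∪q ⁅ y ⁆

  step-¬P : ∀ A y → ¬ P A → ¬ P (step A y)
  step-¬P A y ¬PA with P? (A ∪ ⁅ y ⁆)
  ... | yes _  = ¬PA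
  ... | no ¬PA∪y = ¬PA∪y

  step-settles : ∀ A y → P (A ∪ ⁅ y ⁆) ⊎ y ∈ step A y
  step-settles A y with P? (A ∪ ⁅ y ⁆)
  ... | yes PA∪y = inj₁ PA∪y
  ... | no  _    = inj₂ (q⊆p∪q A ⁅ y ⁆ (x∈⁅x⁆ y))

  grow : Subset n → List (Fin n) → Subset n
  grow = foldl step

  grow-⊆ : ∀ A ys → A ⊆ grow A ys
  grow-⊆ A []       = id
  grow-⊆ A (y ∷ ys) = grow-⊆ (step A y) ys ∘ step-⊆ A y

  grow-¬P : ∀ A ys → ¬ P A → ¬ P (grow A ys)
  grow-¬P A []       ¬PA = ¬PA
  grow-¬P A (y ∷ ys) ¬PA = grow-¬P (step A y) ys (step-¬P A y ¬PA)

  grow-settles : ∀ A ys y → y ∈ₗ ys → y ∉ grow A ys → P (grow A ys ∪ ⁅ y ⁆)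
  grow-settles A (y ∷ ys) y (here refl) y∉ with step-settles A y
  ... | inj₁ PA∪y = P-mono (∪-monoˡ ⁅ y ⁆ (grow-⊆ (step A y) ys ∘ step-⊆ A y)) PA∪y
  ... | inj₂ y∈  = contradiction (grow-⊆ (step A y) ys y∈) y∉
  grow-settles A (z ∷ ys) y (there y∈ys) y∉ = grow-settles (step A z) ys y y∈ys y∉

  maximalNon : ∀ {A₀} → ¬ P A₀ → ∃ (MaximalNon P)
  maximalNon {A₀} ¬PA₀ =
    grow A₀ (allFin n) ,
    grow-¬P A₀ (allFin n) ¬PA₀ ,
    λ y → grow-settles A₀ (allFin n) y (∈-allFin y)

module Neighbourhood {n : ℕ} (G : Graph n) where
  open Graph G using (irrefl)

  ∈N-sym : ∀ {u v} → v ∈ N G u → u ∈ N G v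
  ∈N-sym {u} {v} v∈ = ∈-tabulate⁺ (trans (Graph.sym G v u) (∈-tabulate⁻ v∈))

  ∉N-self : ∀ v → v ∉ N G v
  ∉N-self v v∈ with trans (sym (irrefl v)) (∈-tabulate⁻ v∈)
  ... | ()

module _ {n : ℕ} (G : Graph n) {m : ℕ} {π : Fin n → Fin m} where

  ∈-classOf⁻ : ∀ {v i} → v ∈ classOf G π i → π v ≡ i
  ∈-classOf⁻ {v} {i} v∈ with π v ≟ i | ∈-tabulate⁻ v∈
  ... | yes e | _  = e
  ... | no _  | ()

  ∈-classOf⁺ : ∀ {v i} → π v ≡ i → v ∈ classOf G π i
  ∈-classOf⁺ {v} {i} e = ∈-tabulate⁺ (trans (isYes≗does (π v ≟ i)) (dec-true (π v ≟ i) e))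

module Domination {n : ℕ} (G : Graph n) (k : ℕ) where
  open Neighbourhood G

  Dominating : Subset n → Set
  Dominating = IsKDominating G k

  dominating? : Decidable Dominating
  dominating? S = all? (λ v → ¬? (v ∈? S) →-dec (k ≤? ∣ N G v ∩ S ∣))

  dominating-mono : ∀ {S T} → S ⊆ T → Dominating S → Dominating T
  dominating-mono {S} S⊆T domS v v∉T =
    ≤-trans (domS v (v∉T ∘ S⊆T)) (p⊆q⇒∣p∣≤∣q∣ (∩-monoʳ (N G v) S⊆T))

  ¬dominating-⊥ : 0 < k → Fin n → ¬ Dominating ⊥
  ¬dominating-⊥ 0<k v dom⊥ with ≤-trans 0<k (≤-trans (dom⊥ v ∉⊥)
                                  (subst (∣ N G v ∩ ⊥ ∣ ≤_) (∣⊥∣≡0 n) (∣p∩q∣≤∣q∣ (N G v) ⊥)))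
  ... | ()

  undominatedVertex : ∀ {S} → ¬ Dominating S → ∃ λ w → w ∉ S × ∣ N G w ∩ S ∣ < k
  undominatedVertex {S} ¬domS
    with ¬∀⟶∃¬ n _ (λ v → ¬? (v ∈? S) →-dec (k ≤? ∣ N G v ∩ S ∣)) ¬domS
  ... | w , ¬dominated =
    w , (λ w∈S → ¬dominated (λ w∉S → contradiction w∈S w∉S)) , ≰⇒> (¬dominated ∘ const)

  dominated⇒neighbourIn : 0 < k → ∀ {S v} → Dominating S → v ∉ S → Nonempty (N G v ∩ S)
  dominated⇒neighbourIn 0<k domS v∉S = 0<∣p∣⇒Nonempty (≤-trans 0<k (domS _ v∉S))

  dominatedBy⁅⁆⇒adjacent : 0 < k → ∀ {u y} → Dominating ⁅ y ⁆ → u ≢ y → y ∈ N G u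
  dominatedBy⁅⁆⇒adjacent 0<k {u} {y} domy u≢y
    with dominated⇒neighbourIn 0<k domy (x≢y⇒x∉⁅y⁆ u≢y)
  ... | x , x∈ with x∈p∩q⁻ (N G u) ⁅ y ⁆ x∈
  ...   | x∈Nu , x∈y = subst (_∈ N G u) (x∈⁅y⁆⇒x≡y y x∈y) x∈Nu

  dominating⁅⁆⇒k≤1 : ∀ {y} → 0 < deg G y → Dominating ⁅ y ⁆ → k ≤ 1
  dominating⁅⁆⇒k≤1 {y} 0<deg domy with 0<∣p∣⇒Nonempty 0<deg
  ... | u , u∈Ny = ≤-trans (domy u (x≢y⇒x∉⁅y⁆ u≢y))
                     (subst (∣ N G u ∩ ⁅ y ⁆ ∣ ≤_) (∣⁅x⁆∣≡1 y) (∣p∩q∣≤∣q∣ (N G u) ⁅ y ⁆))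
    where
    u≢y : u ≢ y
    u≢y refl = ∉N-self u u∈Ny

  IsCoalitionBlock : (Fin n → Subset n) → Fin n → Set
  IsCoalitionBlock block v =
    (Dominating (block v) × ∣ block v ∣ ≡ k)
    ⊎ (∃ λ u → u ∉ block v × IsKCoalition G k (block v) (block u))

  coalitionPartition : (block : Fin n → Subset n) →
                       (∀ v → v ∈ block v) →
                       (∀ v {u} → u ∈ block v → block u ≡ block v) →
                       (∀ v → IsCoalitionBlock block v) →
                       HasKCoalitionPartition G k
  coalitionPartition block ∈block block-closed isBlock =
    size , surjection ,
    strictlySurjective⇒surjective trans (cong surjection) surjective , classCondition
    where
    open ImageFactorisation (imageFactorisation (≡-dec Bool._≟_) block)

    class≡block : ∀ v → classOf G surjection (surjection v) ≡ block v
    class≡block v = ⊆-antisym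
      (λ {u} u∈ → subst (u ∈_) (surjection-kernel (∈-classOf⁻ G u∈)) (∈block u))
      (λ u∈ → ∈-classOf⁺ G (kernel-surjection (block-closed v u∈)))

    classCondition : ∀ i →
      (Dominating (classOf G surjection i) × ∣ classOf G surjection i ∣ ≡ k)
      ⊎ (Σ (Fin size) λ j → j ≢ i × IsKCoalition G k (classOf G surjection i) (classOf G surjection j))
    classCondition i with surjective i
    ... | v , refl rewrite class≡block v with isBlock v
    ...   | inj₁ dominatingOfSizeK = inj₁ dominatingOfSizeK
    ...   | inj₂ (u , u∉ , coalition) =
      inj₂ ( surjection u
           , (λ e → u∉ (subst (u ∈_) (surjection-kernel e) (∈block u)))
           , subst (IsKCoalition G k (block v)) (sym (class≡block u)) coalition )

  module _ (0<k : 0 < k) (δ≥k : MinDegreeAtLeast G k)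
           {A : Subset n} (A-max : MaximalNon Dominating A) where

    private
      ¬domA = proj₁ A-max
      maximal = proj₂ A-max

    dominating⁅⁆⇒k≡1 : ∀ {y} → Dominating ⁅ y ⁆ → k ≡ 1
    dominating⁅⁆⇒k≡1 domy = ≤-antisym (dominating⁅⁆⇒k≤1 (≤-trans 0<k (δ≥k _)) domy) 0<k

    singletonOutsideA : ∀ {y} → y ∉ A →
                     (Dominating ⁅ y ⁆ × ∣ ⁅ y ⁆ ∣ ≡ k)
                     ⊎ (Nonempty A × IsKCoalition G k ⁅ y ⁆ A)
    singletonOutsideA {y} y∉A with dominating? ⁅ y ⁆
    ... | yes domy = inj₁ (domy , trans (∣⁅x⁆∣≡1 y) (sym (dominating⁅⁆⇒k≡1 domy)))
    ... | no ¬domy = inj₂ (A-nonempty , ¬domy , ¬domA ,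
                           subst Dominating (∪-comm A ⁅ y ⁆) (maximal y y∉A))
      where
      A-nonempty : Nonempty A
      A-nonempty with nonempty? A
      ... | yes ne   = ne
      ... | no empty = contradiction
        (subst Dominating (trans (cong (_∪ ⁅ y ⁆) (Empty-unique empty)) (∪-identityˡ ⁅ y ⁆))
               (maximal y y∉A))
        ¬domy

    coalitionPartnerOfA : ∀ {x} → x ∈ A → ∃ λ w → w ∉ A × IsKCoalition G k A ⁅ w ⁆
    coalitionPartnerOfA {x} x∈A with undominatedVertex ¬domA
    ... | w , w∉A , fewNeighbours = w , w∉A , ¬domA , ¬domw , maximal w w∉A
      where
      ¬domw : ¬ Dominating ⁅ w ⁆
      ¬domw domw = <⇒≱ fewNeighbours
        (subst (_≤ ∣ N G w ∩ A ∣) (sym (dominating⁅⁆⇒k≡1 domw))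
          (x∈p⇒0<∣p∣ (x∈p∩q⁺ (∈N-sym (dominatedBy⁅⁆⇒adjacent 0<k domw x≢w) , x∈A))))
        where
        x≢w : x ≢ w
        x≢w refl = w∉A x∈A

    isCoalitionBlock : ∀ v → IsCoalitionBlock (blockOf A) v
    isCoalitionBlock v with v ∈? A
    ... | yes v∈A with coalitionPartnerOfA v∈A
    ...   | w , w∉A , coalition =
      inj₂ (w , w∉A , subst (IsKCoalition G k A) (sym (blockOf-outside w∉A)) coalition)
    isCoalitionBlock v | no v∉A with singletonOutsideA v∉A
    ...   | inj₁ dominatingOfSizeK = inj₁ dominatingOfSizeK
    ...   | inj₂ ((a , a∈A) , coalition) =
      inj₂ (a , x≢y⇒x∉⁅y⁆ (λ { refl → v∉A a∈A }) ,
            subst (IsKCoalition G k ⁅ v ⁆) (sym (blockOf-inside {v = a} a∈A)) coalition)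

    maximalNonDominating⇒coalitionPartition : HasKCoalitionPartition G k
    maximalNonDominating⇒coalitionPartition =
      coalitionPartition (blockOf A) (∈-blockOf A) (blockOf-closed A) isCoalitionBlock

theorem1 : (k : ℕ) → 1 ≤ k → (n : ℕ) → (G : Graph n) →
           MinDegreeAtLeast G k → HasKCoalitionPartition G k
theorem1 k 1≤k zero    G δ≥k = 0 , (λ ()) , (λ ()) , (λ ())
theorem1 k 1≤k (suc n) G δ≥k =
  maximalNonDominating⇒coalitionPartition 1≤k δ≥k (proj₂ maximalNonDominating)
  where
  open Domination G k
  maximalNonDominating : ∃ (MaximalNon Dominating)
  maximalNonDominating =
    Greedy.maximalNon dominating? dominating-mono (¬dominating-⊥ 1≤k zero)
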